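{- Let $k \geq 3$ be an integer and let $G_k$ be the graph with vertex set $\{a_i, b_i, c_i : 1 \leq i \leq k\}$ (all indices taken modulo $k$, so $a_{k+1}=a_1$, $b_0=b_k$, $c_0=c_k$, etc.) and edge set $\{a_ib_{i-1},\ a_ib_i,\ a_ic_{i-1},\ a_ic_i,\ c_ic_{i+1} : 1 \leq i \leq k\}$. Then $\gamma(G_k) = k$.
   Context: Equivalently, $G_k$ is obtained from the cycle $b_1b_2\cdots b_kb_1$ by subdividing each edge $b_ib_{i+1}$ with a new vertex $a_{i+1}$ (and $b_kb_1$ with $a_1$), joining consecutive $a_i$'s into a cycle $a_1a_2\cdots a_ka_1$, subdividing each edge $a_ia_{i+1}$ (and $a_ka_1$) with a new vertex $c_i$ (resp. $c_k$), and joining consecutive $c_i$'s into a cycle $c_1c_2\cdots c_kc_1$. For a graph $G$, a set $D \subseteq V(G)$ is dominating if every vertex not in $D$ has a neighbor in $D$; $\gamma(G)$ is the minimum size of a dominating set. -}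

module Defs where

open import Data.Nat using (ℕ; suc; _≤_)
open import Data.Fin using (Fin; zero; suc; toℕ)
open import Data.Nat.DivMod using (_%_)
open import Data.Nat using (_+_; _∸_; NonZero)
open import Data.Product using (_×_; _,_; Σ; ∃)
open import Data.Sum using (_⊎_)
open import Data.List using (List; length)
open import Data.List.Membership.Propositional using (_∈_)
open import Data.List.Relation.Unary.Unique.Propositional using (Unique)
open import Relation.Binary.PropositionalEquality using (_≡_)

data Kind : Set where
  A B C : Kind

-- Vertices of G_k : (kind, index) with index i ∈ {0,…,k-1} standing for
-- the paper's index i+1 (indices modulo k).
Vertex : ℕ → Set
Vertex k = Kind × Fin k

_≡suc_mod_ : ℕ → ℕ → ℕ → Set
j ≡suc i mod k = j ≡ (suc i) % suc (k ∸ 1)  -- k ≥ 1 assumed where used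

data Edge (k : ℕ) : Vertex k → Vertex k → Set where
  ab-prev : ∀ (i j : Fin k) → toℕ i ≡suc toℕ j mod k → Edge k (A , i) (B , j)
  ab-same : ∀ (i : Fin k) → Edge k (A , i) (B , i)
  ac-prev : ∀ (i j : Fin k) → toℕ i ≡suc toℕ j mod k → Edge k (A , i) (C , j)
  ac-same : ∀ (i : Fin k) → Edge k (A , i) (C , i)
  cc-next : ∀ (i j : Fin k) → toℕ j ≡suc toℕ i mod k → Edge k (C , i) (C , j)

Adj : (k : ℕ) → Vertex k → Vertex k → Set
Adj k u v = Edge k u v ⊎ Edge k v u

Dominating : (k : ℕ) → List (Vertex k) → Set
Dominating k D = ∀ (v : Vertex k) → v ∈ D ⊎ Σ (Vertex k) (λ u → u ∈ D × Adj k v u)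

DominationNumber : (k : ℕ) → ℕ → Set
DominationNumber k n =
  Σ (List (Vertex k)) (λ D → Unique D × Dominating k D × length D ≡ n)
  × (∀ (D : List (Vertex k)) → Unique D → Dominating k D → n ≤ length D)

module Submission where

-- Upper bound: a_1, …, a_k dominate G_k, as b_i and c_i are both
-- adjacent to a_i.  Lower bound: for a dominating set D and D_i = D ∩ {a_i, b_i, c_i}
-- we inject the k indices into D.  An index with D_i ≠ ∅ is sent to the first
-- vertex of D_i.  If D_i = ∅, domination of a_i and b_{i-1} gives |D_{i-1}| ≥ 2
-- unless D_{i-1} = {b_{i-1}}, and then domination of c_{i-1} and b_{i-2} gives
-- |D_{i-2}| ≥ 2; i is sent to the second vertex of D_{i-1}, resp. D_{i-2}.  So an
-- empty index never collides with the index owning that set, and two empty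
-- indices never look at the same set.

open import Defs
open import Data.Nat using (ℕ; zero; suc; _≤_; s≤s)
open import Data.Nat.Properties using (suc-injective; ≤-pred; m≤n⇒m<n∨m≡n)
open import Data.Nat.DivMod using (_%_; n%n≡0; m<n⇒m%n≡m)
open import Data.Fin using (Fin; toℕ; fromℕ; inject₁; _≟_)
open import Data.Fin.Properties using (toℕ-injective; toℕ<n; toℕ-fromℕ; toℕ-inject₁; injective⇒≤)
open import Data.Bool using (Bool; true; false; _∧_; _∨_; not; T)
open import Data.Bool.Properties using (T-≡)
open import Data.Bool.ListAction using (or; any)
open import Data.Empty using (⊥; ⊥-elim)
open import Data.Product using (_×_; _,_; proj₁; proj₂)
open import Data.Product.Properties using (≡-dec)
open import Data.Sum using (_⊎_; inj₁; inj₂)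
open import Data.List using (List; []; _∷_; length; map; allFin; lookup)
open import Data.List.Properties using (length-map; length-tabulate)
open import Data.List.Membership.Propositional using (_∈_; lose)
open import Data.List.Membership.Propositional.Properties using (∈-map⁺; ∈-allFin)
import Data.List.Membership.DecPropositional as DecMembership
open import Data.List.Relation.Unary.Any as Any using (Any; here; there; index)
open import Data.List.Relation.Unary.Any.Properties using (lookup-index; any⁺)
open import Data.List.Relation.Unary.Unique.Propositional using (Unique)
open import Data.List.Relation.Unary.Unique.Propositional.Properties using (map⁺; allFin⁺)
open import Relation.Nullary using (yes; no)
open import Relation.Nullary.Decidable using (isYes; toWitness; fromWitness)
open import Function.Bundles using (Equivalence)
open import Relation.Binary.Definitions using (DecidableEquality)
open import Relation.Binary.PropositionalEquality using (_≡_; _≢_; refl; sym; trans; cong)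

injection⇒≤length : {X : Set} {m : ℕ} (xs : List X) (f : Fin m → X) →
                    (∀ i → f i ∈ xs) → (∀ {i j} → f i ≡ f j → i ≡ j) → m ≤ length xs
injection⇒≤length xs f f∈xs f-injective = injective⇒≤ positions-injective
  where
  positions-injective : ∀ {i j} → index (f∈xs i) ≡ index (f∈xs j) → i ≡ j
  positions-injective {i} {j} e =
    f-injective (trans (lookup-index (f∈xs i)) (trans (cong (lookup xs) e) (sym (lookup-index (f∈xs j)))))

module Cyclic (k' : ℕ) where
  n : ℕ
  n = suc k'

  pr : Fin n → Fin n
  pr Fin.zero    = fromℕ k'
  pr (Fin.suc i) = inject₁ i

  pr-spec : ∀ i → toℕ i ≡suc toℕ (pr i) mod n
  pr-spec Fin.zero    rewrite toℕ-fromℕ k' = sym (n%n≡0 n)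
  pr-spec (Fin.suc i) rewrite toℕ-inject₁ i = sym (m<n⇒m%n≡m (s≤s (toℕ<n i)))

  sucMod-view : ∀ (j : Fin n) → (suc (toℕ j) % n ≡ suc (toℕ j)) ⊎ (toℕ j ≡ k' × suc (toℕ j) % n ≡ 0)
  sucMod-view j with m≤n⇒m<n∨m≡n (≤-pred (toℕ<n j))
  ... | inj₁ j<k' = inj₁ (m<n⇒m%n≡m (s≤s j<k'))
  ... | inj₂ j≡k' rewrite j≡k' = inj₂ (refl , n%n≡0 n)

  sucMod-injective : ∀ {j j' : Fin n} → suc (toℕ j) % n ≡ suc (toℕ j') % n → j ≡ j'
  sucMod-injective {j} {j'} e with sucMod-view j | sucMod-view j'
  ... | inj₁ s  | inj₁ s'       = toℕ-injective (suc-injective (trans (sym s) (trans e s')))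
  ... | inj₁ s  | inj₂ (_ , s') with () ← trans (sym s) (trans e s')
  ... | inj₂ (_ , s) | inj₁ s'  with () ← trans (sym s') (trans (sym e) s)
  ... | inj₂ (last , _) | inj₂ (last' , _) = toℕ-injective (trans last (sym last'))

  pred-unique : ∀ {i j : Fin n} → toℕ i ≡suc toℕ j mod n → j ≡ pr i
  pred-unique {i} e = sucMod-injective (trans (sym e) (pr-spec i))

  succ-unique : ∀ {i u : Fin n} → toℕ u ≡suc toℕ (pr i) mod n → u ≡ i
  succ-unique {i} e = toℕ-injective (trans e (sym (pr-spec i)))

  pr-injective : ∀ {i j} → pr i ≡ pr j → i ≡ j
  pr-injective {i} {j} e = succ-unique (trans (pr-spec i) (cong (λ x → suc (toℕ x) % n) e))

-- A profile records which of a_j, b_j, c_j belong to the dominating set.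
Profile : Set
Profile = Bool × Bool × Bool

has : Kind → Profile → Bool
has A (a , b , c) = a
has B (a , b , c) = b
has C (a , b , c) = c

occupied : Profile → Bool
occupied (a , b , c) = a ∨ b ∨ c

onlyB : Profile → Bool
onlyB (a , b , c) = not a ∧ b ∧ not c

several : Profile → Bool
several (a , b , c) = (a ∧ (b ∨ c)) ∨ (b ∧ c)

first : Profile → Kind
first (true  , _     , _) = A
first (false , true  , _) = B
first (false , false , _) = C

second : Profile → Kind
second (true  , true  , _) = B
second (true  , false , _) = C
second (false , _     , _) = C

has-first : ∀ p → occupied p ≡ true → has (first p) p ≡ true
has-first (true  , _     , _)     _ = refl
has-first (false , true  , _)     _ = refl
has-first (false , false , true)  _ = refl

has-second : ∀ p → several p ≡ true → has (second p) p ≡ true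
has-second (true  , true  , _)    _ = refl
has-second (true  , false , true) _ = refl
has-second (false , true  , true) _ = refl

first≢second : ∀ p → several p ≡ true → first p ≢ second p
first≢second (true  , true  , _)    _ ()
first≢second (true  , false , true) _ ()
first≢second (false , true  , true) _ ()

onlyB-occupied : ∀ p → onlyB p ≡ true → occupied p ≡ false → ⊥
onlyB-occupied (false , true , false) _ ()

-- Domination of a_i, b_{i-1}, c_{i-1} and b_{i-2}, read off the profiles
-- p, q, r of the indices i, i-1, i-2: each closed neighbourhood meets D.
record Dominated (p q r : Profile) : Set where
  constructor dominated
  field
    at-a  : T (or (has A p ∷ has B p ∷ has C p ∷ has B q ∷ has C q ∷ []))
    at-b  : T (or (has B q ∷ has A q ∷ has A p ∷ []))
    at-c  : T (or (has C q ∷ has A q ∷ has A p ∷ has C r ∷ has C p ∷ []))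
    at-b' : T (or (has B r ∷ has A r ∷ has A q ∷ []))

-- If index i is empty and D_{i-1} ≠ {b_{i-1}}, then |D_{i-1}| ≥ 2:
-- a_i needs b_{i-1} or c_{i-1}, and b_{i-1} needs itself or a_{i-1}.
several-behind : ∀ {p q r} → Dominated p q r → occupied p ≡ false → onlyB q ≡ false → several q ≡ true
several-behind {true  , _     , _}     _ () _
several-behind {false , true  , _}     _ () _
several-behind {false , false , true}  _ () _
several-behind {false , false , false} {true  , true  , _}     _ _ _ = refl
several-behind {false , false , false} {true  , false , true}  _ _ _ = refl
several-behind {false , false , false} {true  , false , false} (dominated () _ _ _) _ _
several-behind {false , false , false} {false , true  , true}  _ _ _ = refl
several-behind {false , false , false} {false , true  , false} _ _ ()
several-behind {false , false , false} {false , false , _}     (dominated _ () _ _) _ _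

-- If index i is empty and D_{i-1} = {b_{i-1}}, then |D_{i-2}| ≥ 2:
-- c_{i-1} needs c_{i-2}, and b_{i-2} needs itself or a_{i-2}.
several-two-behind : ∀ {p q r} → Dominated p q r → occupied p ≡ false → onlyB q ≡ true → several r ≡ true
several-two-behind {true  , _     , _}     _ () _
several-two-behind {false , true  , _}     _ () _
several-two-behind {false , false , true}  _ () _
several-two-behind {false , false , false} {true  , _     , _}     _ _ ()
several-two-behind {false , false , false} {false , false , _}     _ _ ()
several-two-behind {false , false , false} {false , true  , true}  _ _ ()
several-two-behind {false , false , false} {false , true  , false} {_     , _     , false} (dominated _ _ () _) _ _
several-two-behind {false , false , false} {false , true  , false} {true  , true  , true}  _ _ _ = refl
several-two-behind {false , false , false} {false , true  , false} {true  , false , true}  _ _ _ = refl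
several-two-behind {false , false , false} {false , true  , false} {false , true  , true}  _ _ _ = refl
several-two-behind {false , false , false} {false , true  , false} {false , false , true}  (dominated _ _ _ ()) _ _

-- How far back an index looks for the vertex it is charged to, and the kind of
-- that vertex, as functions of the profiles p, q, r of indices i, i-1, i-2.
data Offset : Set where
  here back1 back2 : Offset

offset : Profile → Profile → Offset
offset p q with occupied p | onlyB q
... | true  | _     = here
... | false | false = back1
... | false | true  = back2

chargedKind : Profile → Profile → Profile → Kind
chargedKind p q r with offset p q
... | here  = first p
... | back1 = second q
... | back2 = second r

data Charge (p q r : Profile) : Offset → Kind → Set where
  own   : occupied p ≡ true → Charge p q r here (first p)
  prev  : occupied p ≡ false → several q ≡ true → Charge p q r back1 (second q)
  prev2 : onlyB q ≡ true → several r ≡ true → Charge p q r back2 (second r)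

charge : ∀ {p q r} → Dominated p q r → Charge p q r (offset p q) (chargedKind p q r)
charge {p} {q} w with occupied p in occ | onlyB q in onlyb
... | true  | _     = own occ
... | false | false = prev occ (several-behind w occ onlyb)
... | false | true  = prev2 onlyb (several-two-behind w occ onlyb)

meets-closed-neighbourhood : ∀ {k D} → Dominating k D → (v : Vertex k) {xs : List (Vertex k)} →
                             v ∈ xs → (∀ {u} → Adj k v u → u ∈ xs) → Any (_∈ D) xs
meets-closed-neighbourhood dom v v∈xs nbrs∈xs with dom v
... | inj₁ v∈D             = lose v∈xs v∈D
... | inj₂ (u , u∈D , v~u) = lose (nbrs∈xs v~u) u∈D

module Neighbourhoods (k' : ℕ) where
  open Cyclic k'

  N[a] N[b] N[c] : Fin n → List (Vertex n)
  N[a] i = (A , i) ∷ (B , i) ∷ (C , i) ∷ (B , pr i) ∷ (C , pr i) ∷ []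
  N[b] i = (B , pr i) ∷ (A , pr i) ∷ (A , i) ∷ []
  N[c] i = (C , pr i) ∷ (A , pr i) ∷ (A , i) ∷ (C , pr (pr i)) ∷ (C , i) ∷ []

  -- Each list contains all neighbours of its vertex; an edge to index
  -- i ± 1 is located by uniqueness of cyclic predecessor/successor.
  nbrs-a : ∀ i {u} → Adj n (A , i) u → u ∈ N[a] i
  nbrs-a i (inj₁ (ab-same .i))      = there (here refl)
  nbrs-a i (inj₁ (ac-same .i))      = there (there (here refl))
  nbrs-a i (inj₁ (ab-prev .i j e)) with refl ← pred-unique e = there (there (there (here refl)))
  nbrs-a i (inj₁ (ac-prev .i j e)) with refl ← pred-unique e = there (there (there (there (here refl))))
  nbrs-a i (inj₂ ())

  nbrs-b : ∀ i {u} → Adj n (B , pr i) u → u ∈ N[b] i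
  nbrs-b i (inj₁ ())
  nbrs-b i (inj₂ (ab-same .(pr i)))     = there (here refl)
  nbrs-b i (inj₂ (ab-prev u .(pr i) e)) with refl ← succ-unique {i} e = there (there (here refl))

  nbrs-c : ∀ i {u} → Adj n (C , pr i) u → u ∈ N[c] i
  nbrs-c i (inj₂ (ac-same .(pr i)))     = there (here refl)
  nbrs-c i (inj₂ (ac-prev u .(pr i) e)) with refl ← succ-unique {i} e = there (there (here refl))
  nbrs-c i (inj₂ (cc-next u .(pr i) e)) with refl ← pred-unique e = there (there (there (here refl)))
  nbrs-c i (inj₁ (cc-next .(pr i) u e)) with refl ← succ-unique {i} e = there (there (there (there (here refl))))

_≟K_ : DecidableEquality Kind
A ≟K A = yes refl
A ≟K B = no (λ ())
A ≟K C = no (λ ())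
B ≟K A = no (λ ())
B ≟K B = yes refl
B ≟K C = no (λ ())
C ≟K A = no (λ ())
C ≟K B = no (λ ())
C ≟K C = yes refl

module LowerBound (k' : ℕ) (D : List (Vertex (suc k'))) (dom : Dominating (suc k') D) where
  open Cyclic k'
  open Neighbourhoods k'
  open DecMembership (≡-dec _≟K_ (_≟_ {n})) using (_∈?_)

  inD : Vertex n → Bool
  inD v = isYes (v ∈? D)

  profile : Fin n → Profile
  profile j = inD (A , j) , inD (B , j) , inD (C , j)

  in-D : ∀ {v} → inD v ≡ true → v ∈ D
  in-D {v} e = toWitness {a? = v ∈? D} (Equivalence.from T-≡ e)

  present : ∀ K j → has K (profile j) ≡ true → (K , j) ∈ D
  present A j = in-D
  present B j = in-D
  present C j = in-D

  covered : ∀ v {xs} → v ∈ xs → (∀ {u} → Adj n v u → u ∈ xs) → T (any inD xs)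
  covered v v∈xs nbrs∈xs =
    any⁺ inD (Any.map (λ {u} → fromWitness {a? = u ∈? D}) (meets-closed-neighbourhood dom v v∈xs nbrs∈xs))

  window : ∀ i → Dominated (profile i) (profile (pr i)) (profile (pr (pr i)))
  window i = dominated (covered (A , i) (here refl) (nbrs-a i))
                       (covered (B , pr i) (here refl) (nbrs-b i))
                       (covered (C , pr i) (here refl) (nbrs-c i))
                       (covered (B , pr (pr i)) (here refl) (nbrs-b (pr i)))

  back : Offset → Fin n → Fin n
  back here  i = i
  back back1 i = pr i
  back back2 i = pr (pr i)

  ChargeAt : Fin n → Offset → Kind → Set
  ChargeAt i = Charge (profile i) (profile (pr i)) (profile (pr (pr i)))

  charged : Fin n → Vertex n
  charged i = chargedKind (profile i) (profile (pr i)) (profile (pr (pr i))) ,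
              back (offset (profile i) (profile (pr i))) i

  charged-∈ : ∀ {i o K} → ChargeAt i o K → (K , back o i) ∈ D
  charged-∈ {i} (own occ)     = present _ i (has-first (profile i) occ)
  charged-∈ {i} (prev _ two)  = present _ (pr i) (has-second (profile (pr i)) two)
  charged-∈ {i} (prev2 _ two) = present _ (pr (pr i)) (has-second (profile (pr (pr i))) two)

  -- Distinct indices are charged to distinct vertices: an index charged to its
  -- own profile uses the first kind, an empty index the second kind, and an
  -- index looking two steps back sits behind a non-empty one.
  charged-injective : ∀ {i j o o' K K'} → ChargeAt i o K → ChargeAt j o' K' →
                      K ≡ K' → back o i ≡ back o' j → i ≡ j
  charged-injective         (own _)   (own _)       _  i≡j  = i≡j
  charged-injective {j = j} (own _)   (prev _ two)  ek refl = ⊥-elim (first≢second (profile (pr j)) two ek)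
  charged-injective {j = j} (own _)   (prev2 _ two) ek refl = ⊥-elim (first≢second (profile (pr (pr j))) two ek)
  charged-injective {i}     (prev _ two)  (own _)   ek refl = ⊥-elim (first≢second (profile (pr i)) two (sym ek))
  charged-injective {i}     (prev2 _ two) (own _)   ek refl = ⊥-elim (first≢second (profile (pr (pr i))) two (sym ek))
  charged-injective {i} {j} (prev _ _)    (prev _ _)   _ e = pr-injective {i} {j} e
  charged-injective {i} {j} (prev2 _ _)   (prev2 _ _)  _ e = pr-injective {i} {j} (pr-injective {pr i} {pr j} e)
  charged-injective {i} {j} (prev occ _) (prev2 onlyb _) _ e
    with refl ← pr-injective {i} {pr j} e = ⊥-elim (onlyB-occupied (profile i) onlyb occ)
  charged-injective {i} {j} (prev2 onlyb _) (prev occ _) _ e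
    with refl ← pr-injective {j} {pr i} (sym e) = ⊥-elim (onlyB-occupied (profile j) onlyb occ)

  lower : n ≤ length D
  lower = injection⇒≤length D charged (λ i → charged-∈ (charge (window i)))
            (λ {i} {j} e → charged-injective (charge (window i)) (charge (window j)) (cong proj₁ e) (cong proj₂ e))

a-cycle : (k : ℕ) → List (Vertex k)
a-cycle k = map (A ,_) (allFin k)

a-cycle-unique : ∀ k → Unique (a-cycle k)
a-cycle-unique k = map⁺ A-injective (allFin⁺ k)
  where
  A-injective : ∀ {x y : Fin k} → (Kind.A , x) ≡ (A , y) → x ≡ y
  A-injective refl = refl

a-cycle-dominating : ∀ k → Dominating k (a-cycle k)
a-cycle-dominating k (A , i) = inj₁ (∈-map⁺ (A ,_) (∈-allFin i))
a-cycle-dominating k (B , i) = inj₂ ((A , i) , ∈-map⁺ (A ,_) (∈-allFin i) , inj₂ (ab-same i))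
a-cycle-dominating k (C , i) = inj₂ ((A , i) , ∈-map⁺ (A ,_) (∈-allFin i) , inj₂ (ac-same i))

a-cycle-length : ∀ k → length (a-cycle k) ≡ k
a-cycle-length k = trans (length-map _ (allFin k)) (length-tabulate (λ i → i))

-- The bound k ≥ 3 is only used to exclude the empty graph k = 0.
lemma2p7 : (k : ℕ) → 3 ≤ k → DominationNumber k k
lemma2p7 zero ()
lemma2p7 k@(suc k') _ =
  (a-cycle k , a-cycle-unique k , a-cycle-dominating k , a-cycle-length k) ,
  λ D _ dom → LowerBound.lower k' D dom
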